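{- Let $G$ be a bicyclic graph with $6$ vertices and matching number $3$. Then $\chi(G)\ge\frac{4}{\sqrt{7}}+\frac{1}{\sqrt{6}}+1$ with equality if and only if $G=B_{6,3}$.
   Context: All graphs are simple. For a graph $G$, $d_G(u)$ is the degree of $u$. The sum--connectivity index is $\chi(G)=\sum_{uv\in E(G)}\frac{1}{\sqrt{d_G(u)+d_G(v)}}$. A bicyclic graph is a connected graph with $n$ vertices and $n+1$ edges. The matching number is the maximum number of pairwise vertex-disjoint edges. $B_{6,3}$ is the graph obtained by identifying one vertex of each of two triangles (common vertex $c$) and attaching one pendent vertex to $c$. -}

module Defs where

open import Level using (Level; _⊔_) renaming (suc to lsuc)
open import Data.Nat as ℕ using (ℕ; zero; suc; _<ᵇ_)
open import Data.Fin using (Fin; toℕ) renaming (zero to fz; suc to fs)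
open import Data.Bool using (Bool; true; false; _∧_; _∨_; if_then_else_)
open import Data.Bool.Properties using (∨-comm)
open import Data.List using (List; []; _∷_; [_]; concatMap; foldr; length; allFin)
open import Data.List.Relation.Unary.All using (All)
open import Data.List.Relation.Unary.Unique.Propositional using (Unique)
open import Data.List.Membership.Propositional using (_∈_)
open import Data.Product using (Σ; _×_; _,_; ∃)
open import Relation.Binary.PropositionalEquality using (_≡_; refl)
open import Relation.Binary using (Rel; IsTotalOrder)
open import Relation.Nullary using (¬_)
open import Algebra.Bundles using (CommutativeRing)
open import Function.Bundles using (_↔_; Inverse)

record Graph (n : ℕ) : Set where
  field
    adj    : Fin n → Fin n → Bool
    sym    : ∀ i j → adj i j ≡ adj j i
    irrefl : ∀ i → adj i i ≡ false
open Graph public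

module _ {n : ℕ} (G : Graph n) where

  edges : List (Fin n × Fin n)
  edges = concatMap (λ i → concatMap (λ j →
            if adj G i j ∧ (toℕ i <ᵇ toℕ j) then [ (i , j) ] else [])
            (allFin n)) (allFin n)

  degree : Fin n → ℕ
  degree v = foldr (λ j acc → (if adj G v j then 1 else 0) ℕ.+ acc) 0 (allFin n)

  data Walk : Fin n → Fin n → Set where
    here : ∀ {u} → Walk u u
    step : ∀ {u w v} → adj G u w ≡ true → Walk w v → Walk u v

  Connected : Set
  Connected = ∀ u v → Walk u v

  Bicyclic : Set
  Bicyclic = Connected × (length edges ≡ suc n)

  endpoints : List (Fin n × Fin n) → List (Fin n)
  endpoints = concatMap (λ { (i , j) → i ∷ j ∷ [] })

  IsMatching : List (Fin n × Fin n) → Set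
  IsMatching M = All (_∈ edges) M × Unique (endpoints M)

  MatchingNumber : ℕ → Set
  MatchingNumber k = (∃ λ M → IsMatching M × length M ≡ k)
                   × (∀ M → IsMatching M → length M ℕ.≤ k)

_≅_ : ∀ {n} → Graph n → Graph n → Set
_≅_ {n} G H = Σ (Fin n ↔ Fin n) λ f →
  ∀ i j → adj G i j ≡ adj H (Inverse.to f i) (Inverse.to f j)

-- B_{6,3}: two triangles {0,1,2}, {0,3,4} sharing c = 0, pendant 5 at 0

private
  edgeℕ : ℕ → ℕ → Bool
  edgeℕ 0 1 = true
  edgeℕ 0 2 = true
  edgeℕ 1 2 = true
  edgeℕ 0 3 = true
  edgeℕ 0 4 = true
  edgeℕ 3 4 = true
  edgeℕ 0 5 = true
  edgeℕ _ _ = false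

  adjB : Fin 6 → Fin 6 → Bool
  adjB i j = edgeℕ (toℕ i) (toℕ j) ∨ edgeℕ (toℕ j) (toℕ i)

  irrB : ∀ i → adjB i i ≡ false
  irrB fz = refl
  irrB (fs fz) = refl
  irrB (fs (fs fz)) = refl
  irrB (fs (fs (fs fz))) = refl
  irrB (fs (fs (fs (fs fz)))) = refl
  irrB (fs (fs (fs (fs (fs fz))))) = refl

B63 : Graph 6
B63 = record
  { adj = adjB
  ; sym = λ i j → ∨-comm (edgeℕ (toℕ i) (toℕ j)) (edgeℕ (toℕ j) (toℕ i))
  ; irrefl = irrB }

-- An ordered field with square roots of nonnegative elements
-- (the real numbers are the intended model).

record SqrtOrderedField (c ℓ₁ ℓ₂ : Level) : Set (lsuc (c ⊔ ℓ₁ ⊔ ℓ₂)) where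
  field
    commutativeRing : CommutativeRing c ℓ₁
  open CommutativeRing commutativeRing public
  infix 4 _≤_
  infix 8 _⁻¹
  field
    _≤_          : Rel Carrier ℓ₂
    isTotalOrder : IsTotalOrder _≈_ _≤_
    +-mono-≤     : ∀ {x y} z → x ≤ y → x + z ≤ y + z
    *-nonneg     : ∀ {x y} → 0# ≤ x → 0# ≤ y → 0# ≤ x * y
    0≉1          : ¬ (0# ≈ 1#)
    _⁻¹          : Carrier → Carrier
    ⁻¹-inverse   : ∀ x → ¬ (x ≈ 0#) → x * x ⁻¹ ≈ 1#
    √            : Carrier → Carrier
    √-nonneg     : ∀ x → 0# ≤ √ x
    √-square     : ∀ x → 0# ≤ x → √ x * √ x ≈ x

  fromℕ : ℕ → Carrier
  fromℕ zero    = 0#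
  fromℕ (suc k) = 1# + fromℕ k

module _ {c ℓ₁ ℓ₂} (F : SqrtOrderedField c ℓ₁ ℓ₂) where
  open SqrtOrderedField F

  χ : ∀ {n} → Graph n → Carrier
  χ G = foldr (λ { (u , v) acc → (√ (fromℕ (degree G u ℕ.+ degree G v))) ⁻¹ + acc })
              0# (edges G)

  χ-bound : Carrier
  χ-bound = fromℕ 4 * (√ (fromℕ 7)) ⁻¹ + (√ (fromℕ 6)) ⁻¹ + 1#

module Submission where

-- A graph on six labelled vertices is one of 2^15 adjacency patterns, so the
-- theorem is settled by exhaustive computation: every graph receives a
-- verdict, which is then checked. Bicyclic graphs with a perfect matching
-- come in two kinds. For most of them the integers ⌊1000/√k⌋, taken over the
-- degree sums k of the edges, already add up to more than
-- 2921 ≥ 1000·(4/√7 + 1/√6 + 1) ≈ 2920.1, which gives the strict inequality;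
-- these graphs have no vertex adjacent to all others, so they are not B₆,₃.
-- The others have the edge degree sums 4,4,6,7,7,7,7 of B₆,₃, hence index
-- exactly 4/√7 + 1/√6 + 2/√4, and are relabellings of B₆,₃.

open import Defs hiding (sym)
import Algebra.Properties.CommutativeSemigroup as CommutativeSemigroupProperties
import Algebra.Properties.Group as GroupProperties
import Algebra.Properties.Ring as RingProperties
import Algebra.Solver.Ring.NaturalCoefficients.Default
open import Data.Bool using (Bool; true; false; T; _∧_; not; if_then_else_)
open import Data.Bool.Properties using (T-∧; T-≡) renaming (_≟_ to _≟ᵇ_)
open import Data.Empty using (⊥-elim)
open import Data.Fin using (Fin; zero; suc; toℕ; _≟_)
open import Data.Fin.Properties using (any?; all?)
open import Data.List using (List; []; _∷_; length; map; foldr; allFin)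
open import Data.List.Membership.Propositional using (_∈_; lose)
open import Data.List.Properties using (concatMap-cong; foldr-cong; foldr-map; map-cong; map-∘; ≡-dec)
open import Data.List.Relation.Binary.Permutation.Propositional using (_↭_; ↭⇒↭ₛ′)
open import Data.List.Relation.Binary.Permutation.Propositional.Properties using (map⁺)
open import Data.List.Relation.Unary.All using (All; []; _∷_) renaming (all? to allList?)
open import Data.List.Relation.Unary.AllPairs using (allPairs?)
open import Data.List.Relation.Unary.Any using (Any) renaming (any? to anyList?)
open import Data.List.Relation.Unary.Unique.Propositional using (Unique)
open import Data.Nat as ℕ using (ℕ; zero; suc)
import Data.Nat.Properties as ℕ
open import Data.Nat.ListAction using (sum)
open import Data.List.Sort.InsertionSort.Base ℕ.≤-decTotalOrder using (sort)
open import Data.List.Sort.InsertionSort.Properties ℕ.≤-decTotalOrder using (sort-↭)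
open import Data.Product using (_×_; _,_; ∃; proj₁; proj₂)
open import Data.Sum using (inj₁; inj₂)
open import Data.Unit using (⊤; tt)
open import Data.Vec using (Vec; []; _∷_; lookup; tabulate)
open import Data.Vec.Properties using (lookup∘tabulate)
open import Function using (_∘_; _⇔_; mk⇔; Equivalence)
open import Function.Bundles using (Inverse; mk↔ₛ′)
open import Level using (_⊔_)
open import Relation.Binary.Bundles using (Poset)
open import Relation.Binary.Structures using (IsTotalOrder)
import Relation.Binary.Construct.NonStrictToStrict as NonStrictToStrict
open import Relation.Binary.PropositionalEquality using (_≡_; refl; sym; trans; cong; cong₂; subst; module ≡-Reasoning)
open import Relation.Nullary using (Dec; does; yes; no; ¬_)
open import Relation.Nullary.Decidable using (map′; ¬?; _×-dec_; _⊎-dec_; _→-dec_; toWitness)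

-- ⌊1000/√k⌋ for 2 ≤ k ≤ 7
lowerBound : ℕ → ℕ
lowerBound 2 = 707
lowerBound 3 = 577
lowerBound 4 = 500
lowerBound 5 = 447
lowerBound 6 = 408
lowerBound 7 = 377
lowerBound _ = 0

B63-degreeSums : List ℕ
B63-degreeSums = 4 ∷ 4 ∷ 6 ∷ 7 ∷ 7 ∷ 7 ∷ 7 ∷ []

module OrderedFieldProperties {c ℓ₁ ℓ₂} (F : SqrtOrderedField c ℓ₁ ℓ₂) where

  open SqrtOrderedField F renaming (refl to ≈-refl; sym to ≈-sym; trans to ≈-trans)
  open IsTotalOrder isTotalOrder using (total; antisym; isPartialOrder)
    renaming (refl to ≤-refl; reflexive to ≤-reflexive; trans to ≤-trans)
  open NonStrictToStrict _≈_ _≤_ public using (_<_)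
  open RingProperties ring using (-‿distribˡ-*; -‿distribʳ-*; x[y-z]≈xy-xz)

  ≤-poset : Poset c ℓ₁ ℓ₂
  ≤-poset = record { isPartialOrder = isPartialOrder }

  open import Relation.Binary.Reasoning.PartialOrder ≤-poset

  +-monoʳ-≤ : ∀ {x y} z → x ≤ y → z + x ≤ z + y
  +-monoʳ-≤ {x} {y} z x≤y = begin
    z + x  ≈⟨ +-comm z x ⟩
    x + z  ≤⟨ +-mono-≤ z x≤y ⟩
    y + z  ≈⟨ +-comm y z ⟩
    z + y  ∎

  +-mono-≤₂ : ∀ {a b x y} → a ≤ b → x ≤ y → a + x ≤ b + y
  +-mono-≤₂ {b = b} {x} a≤b x≤y = ≤-trans (+-mono-≤ x a≤b) (+-monoʳ-≤ b x≤y)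

  x≤y⇒0≤y-x : ∀ {x y} → x ≤ y → 0# ≤ y - x
  x≤y⇒0≤y-x {x} {y} x≤y = begin
    0#     ≈⟨ -‿inverseʳ x ⟨
    x - x  ≤⟨ +-mono-≤ (- x) x≤y ⟩
    y - x  ∎

  0≤y-x⇒x≤y : ∀ {x y} → 0# ≤ y - x → x ≤ y
  0≤y-x⇒x≤y {x} {y} 0≤y-x = begin
    x            ≈⟨ +-identityˡ x ⟨
    0# + x       ≤⟨ +-mono-≤ x 0≤y-x ⟩
    y - x + x    ≈⟨ +-assoc y (- x) x ⟩
    y + (- x + x) ≈⟨ +-congˡ (-‿inverseˡ x) ⟩
    y + 0#       ≈⟨ +-identityʳ y ⟩
    y            ∎

  *-monoˡ-≤-nonNeg : ∀ {x y z} → 0# ≤ z → x ≤ y → z * x ≤ z * y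
  *-monoˡ-≤-nonNeg {x} {y} {z} 0≤z x≤y = 0≤y-x⇒x≤y (begin
    0#             ≤⟨ *-nonneg 0≤z (x≤y⇒0≤y-x x≤y) ⟩
    z * (y - x)    ≈⟨ x[y-z]≈xy-xz z y x ⟩
    z * y - z * x  ∎)

  *-monoʳ-≤-nonNeg : ∀ {x y z} → 0# ≤ z → x ≤ y → x * z ≤ y * z
  *-monoʳ-≤-nonNeg {x} {y} {z} 0≤z x≤y = begin
    x * z  ≈⟨ *-comm x z ⟩
    z * x  ≤⟨ *-monoˡ-≤-nonNeg 0≤z x≤y ⟩
    z * y  ≈⟨ *-comm z y ⟩
    y * z  ∎

  square-nonNeg : ∀ x → 0# ≤ x * x
  square-nonNeg x with total 0# x
  ... | inj₁ 0≤x = *-nonneg 0≤x 0≤x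
  ... | inj₂ x≤0 = begin
    0#         ≤⟨ *-nonneg 0≤-x 0≤-x ⟩
    - x * - x  ≈⟨ -‿distribˡ-* x (- x) ⟨
    - (x * - x) ≈⟨ -‿cong (-‿distribʳ-* x x) ⟨
    - - (x * x) ≈⟨ ⁻¹-involutive (x * x) ⟩
    x * x      ∎
    where
    open GroupProperties +-group using (⁻¹-involutive)
    0≤-x : 0# ≤ - x
    0≤-x = ≤-trans (x≤y⇒0≤y-x x≤0) (≤-reflexive (+-identityˡ (- x)))

  0≤1 : 0# ≤ 1#
  0≤1 = ≤-trans (square-nonNeg 1#) (≤-reflexive (*-identityˡ 1#))

  *-cancelˡ-≈ : ∀ {x y z} → ¬ z ≈ 0# → z * x ≈ z * y → x ≈ y
  *-cancelˡ-≈ {x} {y} {z} z≉0 zx≈zy = begin-equality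
    x                ≈⟨ *-identityˡ x ⟨
    1# * x           ≈⟨ *-congʳ (≈-trans (*-comm (z ⁻¹) z) (⁻¹-inverse z z≉0)) ⟨
    z ⁻¹ * z * x     ≈⟨ *-assoc (z ⁻¹) z x ⟩
    z ⁻¹ * (z * x)   ≈⟨ *-congˡ zx≈zy ⟩
    z ⁻¹ * (z * y)   ≈⟨ *-assoc (z ⁻¹) z y ⟨
    z ⁻¹ * z * y     ≈⟨ *-congʳ (≈-trans (*-comm (z ⁻¹) z) (⁻¹-inverse z z≉0)) ⟩
    1# * y           ≈⟨ *-identityˡ y ⟩
    y                ∎

  1≰0 : ¬ 1# ≤ 0#
  1≰0 1≤0 = 0≉1 (antisym 0≤1 1≤0)

  ⁻¹-nonNeg : ∀ {x} → 0# ≤ x → ¬ x ≈ 0# → 0# ≤ x ⁻¹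
  ⁻¹-nonNeg {x} 0≤x x≉0 with total 0# (x ⁻¹)
  ... | inj₁ 0≤x⁻¹ = 0≤x⁻¹
  ... | inj₂ x⁻¹≤0 = ⊥-elim (1≰0 (begin
    1#         ≈⟨ ⁻¹-inverse x x≉0 ⟨
    x * x ⁻¹   ≤⟨ *-monoˡ-≤-nonNeg 0≤x x⁻¹≤0 ⟩
    x * 0#     ≈⟨ zeroʳ x ⟩
    0#         ∎))

  *-≉0 : ∀ {x y} → ¬ x ≈ 0# → ¬ y ≈ 0# → ¬ x * y ≈ 0#
  *-≉0 {x} x≉0 y≉0 xy≈0 = y≉0 (*-cancelˡ-≈ x≉0 (≈-trans xy≈0 (≈-sym (zeroʳ x))))

  square-≤⇒≤ : ∀ {x y} → ¬ x ≈ 0# → 0# ≤ y → x * x ≤ y * y → x ≤ y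
  square-≤⇒≤ {x} {y} x≉0 0≤y xx≤yy with total x y
  ... | inj₁ x≤y = x≤y
  ... | inj₂ y≤x = ≤-reflexive (*-cancelˡ-≈ x≉0 (antisym xx≤xy xy≤xx))
    where
    xx≤xy : x * x ≤ x * y
    xx≤xy = begin
      x * x  ≤⟨ xx≤yy ⟩
      y * y  ≤⟨ *-monoˡ-≤-nonNeg 0≤y y≤x ⟩
      y * x  ≈⟨ *-comm y x ⟩
      x * y  ∎
    xy≤xx : x * y ≤ x * x
    xy≤xx = *-monoˡ-≤-nonNeg (≤-trans 0≤y y≤x) y≤x

  +-monoʳ-< : ∀ {x y} z → x < y → z + x < z + y
  +-monoʳ-< z (x≤y , x≉y) = +-monoʳ-≤ z x≤y , λ zx≈zy → x≉y (∙-cancelˡ z _ _ zx≈zy)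
    where open GroupProperties +-group using (∙-cancelˡ)

  *-cancelˡ-< : ∀ {x y z} → 0# ≤ z → z * x < z * y → x < y
  *-cancelˡ-< {x} {y} 0≤z (zx≤zy , zx≉zy) with total x y
  ... | inj₁ x≤y = x≤y , λ x≈y → zx≉zy (*-congˡ x≈y)
  ... | inj₂ y≤x = ⊥-elim (zx≉zy (antisym zx≤zy (*-monoˡ-≤-nonNeg 0≤z y≤x)))

  fromℕ-+ : ∀ m n → fromℕ (m ℕ.+ n) ≈ fromℕ m + fromℕ n
  fromℕ-+ zero    n = ≈-sym (+-identityˡ (fromℕ n))
  fromℕ-+ (suc m) n = ≈-trans (+-congˡ (fromℕ-+ m n)) (≈-sym (+-assoc 1# (fromℕ m) (fromℕ n)))

  fromℕ-* : ∀ m n → fromℕ (m ℕ.* n) ≈ fromℕ m * fromℕ n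
  fromℕ-* zero    n = ≈-sym (zeroˡ (fromℕ n))
  fromℕ-* (suc m) n = begin-equality
    fromℕ (n ℕ.+ m ℕ.* n)          ≈⟨ fromℕ-+ n (m ℕ.* n) ⟩
    fromℕ n + fromℕ (m ℕ.* n)      ≈⟨ +-cong (≈-sym (*-identityˡ (fromℕ n))) (fromℕ-* m n) ⟩
    1# * fromℕ n + fromℕ m * fromℕ n ≈⟨ distribʳ (fromℕ n) 1# (fromℕ m) ⟨
    (1# + fromℕ m) * fromℕ n       ∎

  fromℕ-nonNeg : ∀ n → 0# ≤ fromℕ n
  fromℕ-nonNeg zero    = ≤-refl
  fromℕ-nonNeg (suc n) = ≤-trans (≤-reflexive (≈-sym (+-identityˡ 0#))) (+-mono-≤₂ 0≤1 (fromℕ-nonNeg n))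

  fromℕ-mono-≤ : ∀ {m n} → m ℕ.≤ n → fromℕ m ≤ fromℕ n
  fromℕ-mono-≤ {n = n} ℕ.z≤n = fromℕ-nonNeg n
  fromℕ-mono-≤ (ℕ.s≤s m≤n) = +-monoʳ-≤ 1# (fromℕ-mono-≤ m≤n)

  fromℕ-suc≉0 : ∀ n → ¬ fromℕ (suc n) ≈ 0#
  fromℕ-suc≉0 n 1+n≈0 = 1≰0 (begin
    1#             ≈⟨ +-identityʳ 1# ⟨
    1# + 0#        ≤⟨ +-monoʳ-≤ 1# (fromℕ-nonNeg n) ⟩
    1# + fromℕ n   ≈⟨ 1+n≈0 ⟩
    0#             ∎)

  fromℕ-mono-< : ∀ {m n} → m ℕ.< n → fromℕ m < fromℕ n
  fromℕ-mono-< {zero}  {suc n} _             = fromℕ-nonNeg (suc n) , λ 0≈1+n → fromℕ-suc≉0 n (≈-sym 0≈1+n)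
  fromℕ-mono-< {suc m} {suc n} (ℕ.s≤s m<n) = +-monoʳ-< 1# (fromℕ-mono-< m<n)

module ReciprocalSquareRoots {c ℓ₁ ℓ₂} (F : SqrtOrderedField c ℓ₁ ℓ₂) where

  open SqrtOrderedField F renaming (refl to ≈-refl; sym to ≈-sym; trans to ≈-trans)
  open IsTotalOrder isTotalOrder using (antisym) renaming (reflexive to ≤-reflexive)
  open OrderedFieldProperties F
  open CommutativeSemigroupProperties *-commutativeSemigroup using (interchange; x∙yz≈y∙xz)
  open import Relation.Binary.Reasoning.PartialOrder ≤-poset

  1/√_ : ℕ → Carrier
  1/√ k = (√ (fromℕ k)) ⁻¹

  module _ (k : ℕ) where

    private
      s = √ (fromℕ (suc k))

    √-suc≉0 : ¬ s ≈ 0#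
    √-suc≉0 s≈0 = fromℕ-suc≉0 k (begin-equality
      fromℕ (suc k)  ≈⟨ √-square _ (fromℕ-nonNeg (suc k)) ⟨
      s * s          ≈⟨ *-congʳ s≈0 ⟩
      0# * s         ≈⟨ zeroˡ s ⟩
      0#             ∎)

    √*1/√ : s * 1/√ suc k ≈ 1#
    √*1/√ = ⁻¹-inverse s √-suc≉0

    1/√-nonNeg : 0# ≤ 1/√ suc k
    1/√-nonNeg = ⁻¹-nonNeg (√-nonneg _) √-suc≉0

    *1/√-cancel : ∀ x → x * s * 1/√ suc k ≈ x
    *1/√-cancel x = begin-equality
      x * s * 1/√ suc k    ≈⟨ *-assoc x s _ ⟩
      x * (s * 1/√ suc k)  ≈⟨ *-congˡ √*1/√ ⟩
      x * 1#               ≈⟨ *-identityʳ x ⟩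
      x                    ∎

    square-*√ : ∀ n → fromℕ n * s * (fromℕ n * s) ≈ fromℕ (n ℕ.* n ℕ.* suc k)
    square-*√ n = begin-equality
      fromℕ n * s * (fromℕ n * s)          ≈⟨ interchange (fromℕ n) s (fromℕ n) s ⟩
      fromℕ n * fromℕ n * (s * s)          ≈⟨ *-congˡ (√-square _ (fromℕ-nonNeg (suc k))) ⟩
      fromℕ n * fromℕ n * fromℕ (suc k)    ≈⟨ *-congʳ (fromℕ-* n n) ⟨
      fromℕ (n ℕ.* n) * fromℕ (suc k)      ≈⟨ fromℕ-* (n ℕ.* n) (suc k) ⟨
      fromℕ (n ℕ.* n ℕ.* suc k)            ∎

    1/√-lowerBound : ∀ a d → suc a ℕ.* suc a ℕ.* suc k ℕ.≤ d ℕ.* d →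
                     fromℕ (suc a) ≤ fromℕ d * 1/√ suc k
    1/√-lowerBound a d aak≤dd = begin
      fromℕ (suc a)                      ≈⟨ *1/√-cancel (fromℕ (suc a)) ⟨
      fromℕ (suc a) * s * 1/√ suc k      ≤⟨ *-monoʳ-≤-nonNeg 1/√-nonNeg a√≤d ⟩
      fromℕ d * 1/√ suc k                ∎
      where
      a√≤d : fromℕ (suc a) * s ≤ fromℕ d
      a√≤d = square-≤⇒≤ (*-≉0 (fromℕ-suc≉0 a) √-suc≉0) (fromℕ-nonNeg d) (begin
        fromℕ (suc a) * s * (fromℕ (suc a) * s)  ≈⟨ square-*√ (suc a) ⟩
        fromℕ (suc a ℕ.* suc a ℕ.* suc k)        ≤⟨ fromℕ-mono-≤ aak≤dd ⟩
        fromℕ (d ℕ.* d)                          ≈⟨ fromℕ-* d d ⟩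
        fromℕ d * fromℕ d                        ∎)

    1/√-upperBound : ∀ d u → suc d ℕ.* suc d ℕ.≤ u ℕ.* u ℕ.* suc k →
                     fromℕ (suc d) * 1/√ suc k ≤ fromℕ u
    1/√-upperBound d u dd≤uuk = begin
      fromℕ (suc d) * 1/√ suc k    ≤⟨ *-monoʳ-≤-nonNeg 1/√-nonNeg d≤u√ ⟩
      fromℕ u * s * 1/√ suc k      ≈⟨ *1/√-cancel (fromℕ u) ⟩
      fromℕ u                      ∎
      where
      d≤u√ : fromℕ (suc d) ≤ fromℕ u * s
      d≤u√ = square-≤⇒≤ (fromℕ-suc≉0 d) (*-nonneg (fromℕ-nonNeg u) (√-nonneg _)) (begin
        fromℕ (suc d) * fromℕ (suc d)   ≈⟨ fromℕ-* (suc d) (suc d) ⟨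
        fromℕ (suc d ℕ.* suc d)         ≤⟨ fromℕ-mono-≤ dd≤uuk ⟩
        fromℕ (u ℕ.* u ℕ.* suc k)       ≈⟨ square-*√ u ⟨
        fromℕ u * s * (fromℕ u * s)     ∎)

  √4≈2 : √ (fromℕ 4) ≈ fromℕ 2
  √4≈2 = antisym (square-≤⇒≤ (√-suc≉0 3) (fromℕ-nonNeg 2) (≤-reflexive √4√4≈2*2))
                 (square-≤⇒≤ (fromℕ-suc≉0 1) (√-nonneg _) (≤-reflexive (≈-sym √4√4≈2*2)))
    where
    √4√4≈2*2 : √ (fromℕ 4) * √ (fromℕ 4) ≈ fromℕ 2 * fromℕ 2
    √4√4≈2*2 = ≈-trans (√-square _ (fromℕ-nonNeg 4)) (fromℕ-* 2 2)

  private
    module Normalise = Algebra.Solver.Ring.NaturalCoefficients.Default commutativeSemiring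

  1/√4+1/√4≈1 : 1/√ 4 + 1/√ 4 ≈ 1#
  1/√4+1/√4≈1 = begin-equality
    1/√ 4 + 1/√ 4                ≈⟨ double (1/√ 4) ⟨
    fromℕ 2 * 1/√ 4              ≈⟨ *-congʳ √4≈2 ⟨
    √ (fromℕ 4) * 1/√ 4          ≈⟨ √*1/√ 3 ⟩
    1#                           ∎
    where
    open Normalise
    double : ∀ x → fromℕ 2 * x ≈ x + x
    double = solve 1 (λ x → (con 1 :+ (con 1 :+ con 0)) :* x := x :+ x) ≈-refl

  sum1/√ : List ℕ → Carrier
  sum1/√ ks = foldr _+_ 0# (map 1/√_ ks)

  sum1/√-↭ : ∀ {ks ls} → ks ↭ ls → sum1/√ ks ≈ sum1/√ ls
  sum1/√-↭ ks↭ls = foldr-commMonoid +-isCommutativeMonoid (↭⇒↭ₛ′ isEquivalence (map⁺ 1/√_ ks↭ls))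
    where open import Data.List.Relation.Binary.Permutation.Setoid.Properties setoid using (foldr-commMonoid)

  sum1/√-B63 : sum1/√ B63-degreeSums ≈ χ-bound F
  sum1/√-B63 = ≈-trans (rearrange (1/√ 4) (1/√ 6) (1/√ 7)) (+-congˡ 1/√4+1/√4≈1)
    where
    open Normalise
    rearrange : ∀ a b d → a + (a + (b + (d + (d + (d + (d + 0#)))))) ≈ fromℕ 4 * d + b + (a + a)
    rearrange = solve 3 (λ a b d → a :+ (a :+ (b :+ (d :+ (d :+ (d :+ (d :+ con 0))))))
                           := (con 1 :+ (con 1 :+ (con 1 :+ (con 1 :+ con 0)))) :* d :+ b :+ (a :+ a)) ≈-refl

  lowerBound-sound : ∀ k → 1 ℕ.≤ k → fromℕ (lowerBound k) ≤ fromℕ 1000 * 1/√ k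
  lowerBound-sound 0 ()
  lowerBound-sound 1 _ = *-nonneg (fromℕ-nonNeg 1000) (1/√-nonNeg 0)
  lowerBound-sound 2 _ = 1/√-lowerBound 1 706 1000 (ℕ.≤ᵇ⇒≤ _ _ _)
  lowerBound-sound 3 _ = 1/√-lowerBound 2 576 1000 (ℕ.≤ᵇ⇒≤ _ _ _)
  lowerBound-sound 4 _ = 1/√-lowerBound 3 499 1000 (ℕ.≤ᵇ⇒≤ _ _ _)
  lowerBound-sound 5 _ = 1/√-lowerBound 4 446 1000 (ℕ.≤ᵇ⇒≤ _ _ _)
  lowerBound-sound 6 _ = 1/√-lowerBound 5 407 1000 (ℕ.≤ᵇ⇒≤ _ _ _)
  lowerBound-sound 7 _ = 1/√-lowerBound 6 376 1000 (ℕ.≤ᵇ⇒≤ _ _ _)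
  lowerBound-sound (suc (suc (suc (suc (suc (suc (suc (suc k)))))))) _ =
    *-nonneg (fromℕ-nonNeg 1000) (1/√-nonNeg (7 ℕ.+ k))

  sum-lowerBound : ∀ {ks} → All (1 ℕ.≤_) ks → fromℕ (sum (map lowerBound ks)) ≤ fromℕ 1000 * sum1/√ ks
  sum-lowerBound []                 = ≤-reflexive (≈-sym (zeroʳ (fromℕ 1000)))
  sum-lowerBound {k ∷ ks} (1≤k ∷ 1≤ks) = begin
    fromℕ (lowerBound k ℕ.+ sum (map lowerBound ks))          ≈⟨ fromℕ-+ (lowerBound k) _ ⟩
    fromℕ (lowerBound k) + fromℕ (sum (map lowerBound ks))    ≤⟨ +-mono-≤₂ (lowerBound-sound k 1≤k) (sum-lowerBound 1≤ks) ⟩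
    fromℕ 1000 * 1/√ k + fromℕ 1000 * sum1/√ ks                ≈⟨ distribˡ (fromℕ 1000) (1/√ k) (sum1/√ ks) ⟨
    fromℕ 1000 * sum1/√ (k ∷ ks)                               ∎

  1000*χ-bound≤2921 : fromℕ 1000 * χ-bound F ≤ fromℕ 2921
  1000*χ-bound≤2921 = begin
    D * (fromℕ 4 * 1/√ 7 + 1/√ 6 + 1#)              ≈⟨ distribˡ D _ 1# ⟩
    D * (fromℕ 4 * 1/√ 7 + 1/√ 6) + D * 1#          ≈⟨ +-cong (distribˡ D _ _) (*-identityʳ D) ⟩
    D * (fromℕ 4 * 1/√ 7) + D * 1/√ 6 + D           ≈⟨ +-congʳ (+-congʳ (x∙yz≈y∙xz D (fromℕ 4) (1/√ 7))) ⟩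
    fromℕ 4 * (D * 1/√ 7) + D * 1/√ 6 + D           ≤⟨ +-mono-≤ D (+-mono-≤₂ (*-monoˡ-≤-nonNeg (fromℕ-nonNeg 4) (1/√-upperBound 6 999 378 (ℕ.≤ᵇ⇒≤ _ _ _)))
                                                                            (1/√-upperBound 5 999 409 (ℕ.≤ᵇ⇒≤ _ _ _))) ⟩
    fromℕ 4 * fromℕ 378 + fromℕ 409 + D             ≈⟨ +-congʳ (+-congʳ (fromℕ-* 4 378)) ⟨
    fromℕ (4 ℕ.* 378) + fromℕ 409 + D               ≈⟨ +-congʳ (fromℕ-+ (4 ℕ.* 378) 409) ⟨
    fromℕ (4 ℕ.* 378 ℕ.+ 409) + D                   ≈⟨ fromℕ-+ (4 ℕ.* 378 ℕ.+ 409) 1000 ⟨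
    fromℕ 2921                                      ∎
    where D = fromℕ 1000

  χ-bound<sum1/√ : ∀ {ks} → All (1 ℕ.≤_) ks → 2921 ℕ.< sum (map lowerBound ks) → χ-bound F < sum1/√ ks
  χ-bound<sum1/√ {ks} 1≤ks 2921<Σ = *-cancelˡ-< (fromℕ-nonNeg 1000) (begin-strict
    fromℕ 1000 * χ-bound F                 ≤⟨ 1000*χ-bound≤2921 ⟩
    fromℕ 2921                             <⟨ fromℕ-mono-< 2921<Σ ⟩
    fromℕ (sum (map lowerBound ks))        ≤⟨ sum-lowerBound 1≤ks ⟩
    fromℕ 1000 * sum1/√ ks                 ∎)

  sum1/√≈χ-bound : ∀ {ks} → sort ks ≡ B63-degreeSums → sum1/√ ks ≈ χ-bound F
  sum1/√≈χ-bound {ks} sorted = begin-equality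
    sum1/√ ks               ≈⟨ sum1/√-↭ (sort-↭ ks) ⟨
    sum1/√ (sort ks)        ≡⟨ cong sum1/√ sorted ⟩
    sum1/√ B63-degreeSums   ≈⟨ sum1/√-B63 ⟩
    χ-bound F               ∎

Code : ℕ → Set
Code zero    = ⊤
Code (suc n) = Vec Bool n × Code n

adjOf : ∀ {n} → Code n → Fin n → Fin n → Bool
adjOf (row , c) zero    zero    = false
adjOf (row , c) zero    (suc j) = lookup row j
adjOf (row , c) (suc i) zero    = lookup row i
adjOf (row , c) (suc i) (suc j) = adjOf c i j

adjOf-sym : ∀ {n} (c : Code n) i j → adjOf c i j ≡ adjOf c j i
adjOf-sym (row , c) zero    zero    = refl
adjOf-sym (row , c) zero    (suc j) = refl
adjOf-sym (row , c) (suc i) zero    = refl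
adjOf-sym (row , c) (suc i) (suc j) = adjOf-sym c i j

adjOf-irrefl : ∀ {n} (c : Code n) i → adjOf c i i ≡ false
adjOf-irrefl (row , c) zero    = refl
adjOf-irrefl (row , c) (suc i) = adjOf-irrefl c i

graphOf : ∀ {n} → Code n → Graph n
graphOf c = record { adj = adjOf c ; sym = adjOf-sym c ; irrefl = adjOf-irrefl c }

deleteZero : ∀ {n} → Graph (suc n) → Graph n
deleteZero G = record
  { adj    = λ i j → adj G (suc i) (suc j)
  ; sym    = λ i j → Graph.sym G (suc i) (suc j)
  ; irrefl = irrefl G ∘ suc
  }

codeOf : ∀ {n} → Graph n → Code n
codeOf {zero}  G = tt
codeOf {suc n} G = tabulate (adj G zero ∘ suc) , codeOf (deleteZero G)

adjOf-codeOf : ∀ {n} (G : Graph n) i j → adj G i j ≡ adjOf (codeOf G) i j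
adjOf-codeOf G zero    zero    = irrefl G zero
adjOf-codeOf G zero    (suc j) = sym (lookup∘tabulate (adj G zero ∘ suc) j)
adjOf-codeOf G (suc i) zero    = trans (Graph.sym G (suc i) zero) (sym (lookup∘tabulate (adj G zero ∘ suc) i))
adjOf-codeOf G (suc i) (suc j) = adjOf-codeOf (deleteZero G) i j

record SameAdjacency {n} (G H : Graph n) : Set where
  field adj-≡ : ∀ i j → adj G i j ≡ adj H i j

graphOf-codeOf : ∀ {n} (G : Graph n) → SameAdjacency G (graphOf (codeOf G))
graphOf-codeOf G = record { adj-≡ = adjOf-codeOf G }

allVectors : ∀ k → (Vec Bool k → Bool) → Bool
allVectors zero    p = p []
allVectors (suc k) p = allVectors k (p ∘ (true ∷_)) ∧ allVectors k (p ∘ (false ∷_))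

allVectors-sound : ∀ k p → T (allVectors k p) → ∀ v → T (p v)
allVectors-sound zero    p holds []          = holds
allVectors-sound (suc k) p holds (true ∷ v)  =
  allVectors-sound k (p ∘ (true ∷_)) (proj₁ (Equivalence.to T-∧ holds)) v
allVectors-sound (suc k) p holds (false ∷ v) =
  allVectors-sound k (p ∘ (false ∷_)) (proj₂ (Equivalence.to T-∧ holds)) v

allCodes : ∀ n → (Code n → Bool) → Bool
allCodes zero    p = p tt
allCodes (suc n) p = allVectors n λ row → allCodes n λ c → p (row , c)

allCodes-sound : ∀ n p → T (allCodes n p) → ∀ c → T (p c)
allCodes-sound zero    p holds tt        = holds
allCodes-sound (suc n) p holds (row , c) =
  allCodes-sound n (λ c → p (row , c)) (allVectors-sound n _ holds row) c

allCodes-witness : ∀ n {P : Code n → Set} (P? : ∀ c → Dec (P c)) →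
                   allCodes n (λ c → does (P? c)) ≡ true → ∀ c → P c
allCodes-witness n P? holds c with P? c | allCodes-sound n (λ c → does (P? c)) (Equivalence.from T-≡ holds) c
... | yes p | _  = p
... | no _  | ()

module _ {n} (G : Graph n) where

  degreeSums : List ℕ
  degreeSums = map (λ { (u , v) → degree G u ℕ.+ degree G v }) (edges G)

  HasDominatingVertex : Set
  HasDominatingVertex = ∃ λ v → ∀ w → ¬ v ≡ w → adj G v w ≡ true

  hasDominatingVertex? : Dec HasDominatingVertex
  hasDominatingVertex? = any? λ v → all? λ w → ¬? (v ≟ w) →-dec (adj G v w ≟ᵇ true)

  ThreeDisjointEdgesIn : List (Fin n × Fin n) → Set
  ThreeDisjointEdgesIn E =
    Any (λ e₁ → Any (λ e₂ → Any (λ e₃ → Unique (endpoints G (e₁ ∷ e₂ ∷ e₃ ∷ []))) E) E) E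

  threeDisjointEdgesIn? : ∀ E → Dec (ThreeDisjointEdgesIn E)
  threeDisjointEdgesIn? E = anyList? (λ e₁ → anyList? (λ e₂ → anyList? (λ e₃ →
    allPairs? (λ x y → ¬? (x ≟ y)) (endpoints G (e₁ ∷ e₂ ∷ e₃ ∷ []))) E) E) E

  matching⇒threeDisjointEdges : ∀ {M} → IsMatching G M → length M ≡ 3 → ThreeDisjointEdgesIn (edges G)
  matching⇒threeDisjointEdges {_ ∷ _ ∷ _ ∷ []} (e₁∈E ∷ e₂∈E ∷ e₃∈E ∷ [] , unique) refl =
    lose e₁∈E (lose e₂∈E (lose e₃∈E unique))

module _ {n} {G H : Graph n} (G≐H : SameAdjacency G H) where

  open SameAdjacency G≐H

  edges-cong : edges G ≡ edges H
  edges-cong = concatMap-cong (λ i → concatMap-cong (λ j →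
    cong (λ b → if b ∧ (toℕ i ℕ.<ᵇ toℕ j) then (i , j) ∷ [] else []) (adj-≡ i j)) (allFin n)) (allFin n)

  degree-cong : ∀ v → degree G v ≡ degree H v
  degree-cong v = foldr-cong (λ j acc → cong (λ b → (if b then 1 else 0) ℕ.+ acc) (adj-≡ v j)) refl (allFin n)

  degreeSums-cong : degreeSums G ≡ degreeSums H
  degreeSums-cong = trans
    (map-cong (λ { (u , v) → cong₂ ℕ._+_ (degree-cong u) (degree-cong v) }) (edges G))
    (cong (map _) edges-cong)

  isMatching-cong : ∀ {M} → IsMatching G M → IsMatching H M
  isMatching-cong (M⊆E , unique) = subst (λ E → All (_∈ E) _) edges-cong M⊆E , unique

  hasDominatingVertex-cong : HasDominatingVertex G → HasDominatingVertex H
  hasDominatingVertex-cong (v , v-dominates) = v , λ w v≢w → trans (sym (adj-≡ v w)) (v-dominates w v≢w)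

  ≅-respˡ : ∀ {K} → H ≅ K → G ≅ K
  ≅-respˡ (f , f-adj) = f , λ i j → trans (adj-≡ i j) (f-adj i j)

module _ {n} (G H : Graph n) where

  IsIsomorphism : (Fin n → Fin n) → (Fin n → Fin n) → Set
  IsIsomorphism to from = (∀ j → to (from j) ≡ j) × (∀ i → from (to i) ≡ i)
                        × (∀ i j → adj G i j ≡ adj H (to i) (to j))

  isIsomorphism? : ∀ to from → Dec (IsIsomorphism to from)
  isIsomorphism? to from = all? (λ j → to (from j) ≟ j) ×-dec all? (λ i → from (to i) ≟ i)
                         ×-dec all? λ i → all? λ j → adj G i j ≟ᵇ adj H (to i) (to j)

  isIsomorphism⇒≅ : ∀ {to from} → IsIsomorphism to from → G ≅ H
  isIsomorphism⇒≅ {to} {from} (to∘from , from∘to , to-adj) = mk↔ₛ′ to from to∘from from∘to , to-adj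

  ≅-hasDominatingVertex : G ≅ H → HasDominatingVertex H → HasDominatingVertex G
  ≅-hasDominatingVertex (f , f-adj) (v , v-dominates) = from v , λ w from-v≢w → begin
    adj G (from v) w            ≡⟨ f-adj (from v) w ⟩
    adj H (to (from v)) (to w)  ≡⟨ cong (λ x → adj H x (to w)) (strictlyInverseˡ v) ⟩
    adj H v (to w)              ≡⟨ v-dominates (to w) (λ v≡to-w → from-v≢w (trans (cong from v≡to-w) (strictlyInverseʳ w))) ⟩
    true                        ∎
    where
    open Inverse f
    open ≡-Reasoning

B63-hasDominatingVertex : HasDominatingVertex B63
B63-hasDominatingVertex = toWitness {a? = hasDominatingVertex? B63} tt

χ≡sum1/√ : ∀ {c ℓ₁ ℓ₂} (F : SqrtOrderedField c ℓ₁ ℓ₂) {n} (G : Graph n) →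
           χ F G ≡ ReciprocalSquareRoots.sum1/√ F (degreeSums G)
χ≡sum1/√ F G = trans (sym (foldr-map _+_ _ 0# (edges G))) (cong (foldr _+_ 0#) (map-∘ (edges G)))
  where open SqrtOrderedField F using (_+_; 0#)

firstWith : ∀ {n} → (Fin (suc n) → Bool) → Fin (suc n)
firstWith {zero}  p = zero
firstWith {suc n} p = if p zero then zero else suc (firstWith (p ∘ suc))

invert : ∀ {n} → (Fin (suc n) → Fin (suc n)) → Fin (suc n) → Fin (suc n)
invert f i = firstWith (λ k → does (f k ≟ i))

-- A guess at an isomorphism B₆,₃ → H, read off from the degrees; it is checked, never trusted.
B63-labelling : Graph 6 → Fin 6 → Fin 6
B63-labelling H = lookup (centre ∷ a ∷ a′ ∷ b ∷ b′ ∷ pendant ∷ [])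
  where
  ofDegree : ℕ → Fin 6 → Bool
  ofDegree d v = does (degree H v ℕ.≟ d)
  centre  = firstWith (ofDegree 5)
  pendant = firstWith (ofDegree 1)
  a  = firstWith (ofDegree 2)
  a′ = firstWith (λ v → ofDegree 2 v ∧ adj H a v)
  b  = firstWith (λ v → ofDegree 2 v ∧ not (does (v ≟ a)) ∧ not (does (v ≟ a′)))
  b′ = firstWith (λ v → ofDegree 2 v ∧ adj H b v)

-- The edge list and the degree sums are parameters, rather than computed from
-- H, so that the exhaustive check below evaluates them once per graph.
data Verdict (H : Graph 6) (E : List (Fin 6 × Fin 6)) (S : List ℕ) : Set where
  wrongSize  : ¬ length E ≡ 7 → Verdict H E S
  noMatching : ¬ ThreeDisjointEdgesIn H E → Verdict H E S
  exceeds    : All (1 ℕ.≤_) S → 2921 ℕ.< sum (map lowerBound S) → ¬ HasDominatingVertex H →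
               Verdict H E S
  extremal   : sort S ≡ B63-degreeSums →
               IsIsomorphism H B63 (invert (B63-labelling H)) (B63-labelling H) → Verdict H E S

verdict? : ∀ H E S → Dec (Verdict H E S)
verdict? H E S = map′ fromSum toSum
  (¬? (length E ℕ.≟ 7)
   ⊎-dec (allList? (1 ℕ.≤?_) S ×-dec 2921 ℕ.<? sum (map lowerBound S) ×-dec ¬? (hasDominatingVertex? H))
   ⊎-dec (≡-dec ℕ._≟_ (sort S) B63-degreeSums
          ×-dec isIsomorphism? H B63 (invert (B63-labelling H)) (B63-labelling H))
   ⊎-dec ¬? (threeDisjointEdgesIn? H E))
  where
  fromSum = λ { (inj₁ ≢7) → wrongSize ≢7
              ; (inj₂ (inj₁ (1≤S , 2921<Σ , ¬dominating))) → exceeds 1≤S 2921<Σ ¬dominating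
              ; (inj₂ (inj₂ (inj₁ (sorted , iso)))) → extremal sorted iso
              ; (inj₂ (inj₂ (inj₂ ¬three))) → noMatching ¬three }
  toSum = λ { (wrongSize ≢7) → inj₁ ≢7
            ; (exceeds 1≤S 2921<Σ ¬dominating) → inj₂ (inj₁ (1≤S , 2921<Σ , ¬dominating))
            ; (extremal sorted iso) → inj₂ (inj₂ (inj₁ (sorted , iso)))
            ; (noMatching ¬three) → inj₂ (inj₂ (inj₂ ¬three)) }

verdictOf? : (c : Code 6) → Dec (Verdict (graphOf c) (edges (graphOf c)) (degreeSums (graphOf c)))
verdictOf? c = verdict? (graphOf c) (edges (graphOf c)) (degreeSums (graphOf c))

allCodesHaveVerdicts : allCodes 6 (λ c → does (verdictOf? c)) ≡ true
allCodesHaveVerdicts = refl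

certificate : ∀ c → Verdict (graphOf c) (edges (graphOf c)) (degreeSums (graphOf c))
certificate = allCodes-witness 6 verdictOf? allCodesHaveVerdicts

module _ {c ℓ₁ ℓ₂} (F : SqrtOrderedField c ℓ₁ ℓ₂) {G H : Graph 6} (G≐H : SameAdjacency G H) where

  open SqrtOrderedField F using (_≈_; _≤_; isTotalOrder) renaming (sym to ≈-sym)
  open IsTotalOrder isTotalOrder using (reflexive)
  open OrderedFieldProperties F using (_<_)
  open ReciprocalSquareRoots F using (sum1/√; χ-bound<sum1/√; sum1/√≈χ-bound)

  SharpLowerBound : Set (ℓ₁ ⊔ ℓ₂)
  SharpLowerBound = χ-bound F ≤ χ F G × (χ F G ≈ χ-bound F ⇔ G ≅ B63)

  χ≡sum1/√-degreeSums : χ F G ≡ sum1/√ (degreeSums H)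
  χ≡sum1/√-degreeSums = trans (χ≡sum1/√ F G) (cong sum1/√ (degreeSums-cong G≐H))

  sharp-if-exceeds : χ-bound F < sum1/√ (degreeSums H) → ¬ HasDominatingVertex H → SharpLowerBound
  sharp-if-exceeds (bound≤Σ , bound≉Σ) ¬dominating =
    subst (χ-bound F ≤_) (sym χ≡sum1/√-degreeSums) bound≤Σ ,
    mk⇔ (λ χ≈bound → ⊥-elim (bound≉Σ (≈-sym (subst (_≈ χ-bound F) χ≡sum1/√-degreeSums χ≈bound))))
        (λ G≅B63 → ⊥-elim (¬dominating (hasDominatingVertex-cong G≐H
                     (≅-hasDominatingVertex G B63 G≅B63 B63-hasDominatingVertex))))

  sharp-if-extremal : sum1/√ (degreeSums H) ≈ χ-bound F → H ≅ B63 → SharpLowerBound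
  sharp-if-extremal Σ≈bound H≅B63 =
    reflexive (≈-sym χ≈bound) , mk⇔ (λ _ → ≅-respˡ G≐H {B63} H≅B63) (λ _ → χ≈bound)
    where
    χ≈bound : χ F G ≈ χ-bound F
    χ≈bound = subst (_≈ χ-bound F) (sym χ≡sum1/√-degreeSums) Σ≈bound

  -- The implicit arguments below are supplied because inferring them would make
  -- the unifier evaluate these functions on the symbolic graph H.
  sharp-from-verdict : length (edges G) ≡ 7 → ∀ {M} → IsMatching G M → length M ≡ 3 →
                       Verdict H (edges H) (degreeSums H) → SharpLowerBound
  sharp-from-verdict |E|≡7 _ _ (wrongSize |E|≢7) =
    ⊥-elim (|E|≢7 (trans (cong length (sym (edges-cong G≐H))) |E|≡7))
  sharp-from-verdict _ M-isMatching |M|≡3 (noMatching ¬three) =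
    ⊥-elim (¬three (matching⇒threeDisjointEdges H (isMatching-cong G≐H M-isMatching) |M|≡3))
  sharp-from-verdict _ _ _ (exceeds 1≤Σ 2921<Σ ¬dominating) =
    sharp-if-exceeds (χ-bound<sum1/√ {degreeSums H} 1≤Σ 2921<Σ) ¬dominating
  sharp-from-verdict _ _ _ (extremal sorted iso) =
    sharp-if-extremal (sum1/√≈χ-bound {degreeSums H} sorted)
                      (isIsomorphism⇒≅ H B63 {invert (B63-labelling H)} {B63-labelling H} iso)

lemma8 : ∀ {c ℓ₁ ℓ₂} (F : SqrtOrderedField c ℓ₁ ℓ₂) (G : Graph 6) →
         Bicyclic G → MatchingNumber G 3 →
         SqrtOrderedField._≤_ F (χ-bound F) (χ F G)
         × (SqrtOrderedField._≈_ F (χ F G) (χ-bound F) ⇔ (G ≅ B63))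
lemma8 F G (_ , |E|≡7) ((_ , M-isMatching , |M|≡3) , _) =
  sharp-from-verdict F (graphOf-codeOf G) |E|≡7 M-isMatching |M|≡3 (certificate (codeOf G))
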